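{- Let $G$ be a nice graph in which no two adjacent vertices have the same degree. If $G$ has a quasi-majority $2$-edge-coloring (i.e. $\chi'_{qm}(G)=2$), then $\chi'_{qm\Sigma}(G)=2$.
   Context: All graphs are simple and finite. A $k$-edge-coloring of a graph $G$ is any map $c:E(G)\to[k]$ (adjacent edges may receive the same color). It induces $\sigma_c(v)=\sum_{u\in N(v)}c(vu)$. The coloring is neighbor sum distinguishing (NSD) if $\sigma_c(u)\ne\sigma_c(v)$ for every edge $uv$, and quasi-majority (QM) if every vertex $v$ is incident to at most $\lceil d(v)/2\rceil$ edges of each color. $\chi'_{qm}(G)$ is the minimum $k$ for which $G$ has a QM $k$-edge-coloring. A graph is nice if it has no component isomorphic to $K_2$. $\chi'_{qm\Sigma}(G)$ is the minimum $k$ such that the nice graph $G$ has a QM and NSD $k$-edge-coloring. -}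

module Defs where

open import Data.Nat using (ℕ; zero; suc; _+_; _≤_; ⌈_/2⌉)
open import Data.Fin using (Fin; toℕ)
open import Data.Bool using (Bool; true; false; if_then_else_)
open import Data.List using (List; map; allFin)
open import Data.Nat.ListAction using (sum)
open import Data.Product using (Σ; _×_; _,_)
open import Relation.Binary.PropositionalEquality using (_≡_; _≢_)
open import Relation.Nullary using (¬_)

record Graph : Set where
  field
    n     : ℕ
    adj   : Fin n → Fin n → Bool
    sym   : ∀ u v → adj u v ≡ adj v u
    irref : ∀ v → adj v v ≡ false

open Graph public

sumNbr : (G : Graph) → Fin (n G) → (Fin (n G) → ℕ) → ℕ
sumNbr G v f = sum (map (λ u → if adj G v u then f u else 0) (allFin (n G)))

degree : (G : Graph) → Fin (n G) → ℕ
degree G v = sumNbr G v (λ _ → 1)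

-- A k-edge-coloring: a color in [k] = {1,..,k} (encoded as Fin k, color i ↦ toℕ i + 1)
-- for every ordered pair, required symmetric on edges. Values on non-edges are irrelevant.
record EdgeColoring (G : Graph) (k : ℕ) : Set where
  field
    col    : Fin (n G) → Fin (n G) → Fin k
    colSym : ∀ u v → adj G u v ≡ true → col u v ≡ col v u

open EdgeColoring public

colVal : {G : Graph} {k : ℕ} → EdgeColoring G k → Fin (n G) → Fin (n G) → ℕ
colVal c v u = suc (toℕ (col c v u))

σ : {G : Graph} {k : ℕ} → EdgeColoring G k → Fin (n G) → ℕ
σ {G} c v = sumNbr G v (λ u → colVal c v u)

colorCount : {G : Graph} {k : ℕ} → EdgeColoring G k → Fin (n G) → Fin k → ℕ
colorCount {G} c v i = sumNbr G v (λ u → if ⌊ col c v u ≟F i ⌋ then 1 else 0)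
  where
  open import Data.Fin using () renaming (_≟_ to _≟F_)
  open import Relation.Nullary.Decidable using (⌊_⌋)

IsNSD : {G : Graph} {k : ℕ} → EdgeColoring G k → Set
IsNSD {G} c = ∀ u v → adj G u v ≡ true → σ c u ≢ σ c v

IsQM : {G : Graph} {k : ℕ} → EdgeColoring G k → Set
IsQM {G} c = ∀ v i → colorCount c v i ≤ ⌈ degree G v /2⌉

-- G is nice: no component isomorphic to K₂, i.e. no edge uv with d(u) = d(v) = 1.
Nice : Graph → Set
Nice G = ∀ u v → adj G u v ≡ true → ¬ (degree G u ≡ 1 × degree G v ≡ 1)

AdjDistinctDegrees : Graph → Set
AdjDistinctDegrees G = ∀ u v → adj G u v ≡ true → degree G u ≢ degree G v

HasQM : Graph → ℕ → Set
HasQM G k = Σ (EdgeColoring G k) IsQM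

HasQMΣ : Graph → ℕ → Set
HasQMΣ G k = Σ (EdgeColoring G k) (λ c → IsQM c × IsNSD c)

χqm≡ : Graph → ℕ → Set
χqm≡ G m = HasQM G m × (∀ k → suc k ≤ m → ¬ HasQM G k)

χqmΣ≡ : Graph → ℕ → Set
χqmΣ≡ G m = HasQMΣ G m × (∀ k → suc k ≤ m → ¬ HasQMΣ G k)

-- In a 2-coloring with colors 1 and 2, σ(v) = d(v) + t(v), where t(v) counts the edges
-- at v of color 2. Quasi-majority bounds both color classes by ⌈d(v)/2⌉, so
-- ⌊d(v)/2⌋ ≤ t(v) ≤ ⌈d(v)/2⌉ and σ(v) lies in [d + ⌊d/2⌋, d + ⌈d/2⌉]. These windows
-- are strictly increasing in d, so σ is strictly monotone in the degree and any
-- quasi-majority 2-coloring already distinguishes adjacent vertices of different degrees.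
module Submission where

open import Defs hiding (sym)
open import Algebra.Properties.CommutativeSemigroup using (interchange)
open import Data.Bool using (Bool; true; false; if_then_else_)
open import Data.Fin using (Fin; toℕ) renaming (_≟_ to _≟ᶠ_)
open import Data.Fin.Patterns using (0F; 1F)
open import Data.List using (List; []; _∷_; map; allFin)
open import Data.List.Properties using (map-cong)
open import Data.Nat
open import Data.Nat.ListAction using (sum)
open import Data.Nat.Properties
open import Data.Product using (_,_)
open import Relation.Binary.Definitions using (tri<; tri≈; tri>)
open import Relation.Binary.PropositionalEquality
open import Relation.Nullary.Decidable using (⌊_⌋)

sum-map-+ : {A : Set} (f g : A → ℕ) (xs : List A) →
            sum (map (λ x → f x + g x) xs) ≡ sum (map f xs) + sum (map g xs)
sum-map-+ f g []       = refl
sum-map-+ f g (x ∷ xs) rewrite sum-map-+ f g xs =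
  interchange +-commutativeSemigroup (f x) (g x) (sum (map f xs)) (sum (map g xs))

if-+ : ∀ (b : Bool) x y → (if b then x + y else 0) ≡ (if b then x else 0) + (if b then y else 0)
if-+ true  x y = refl
if-+ false x y = refl

module _ (G : Graph) (v : Fin (n G)) where

  sumNbr-cong : ∀ {f g : Fin (n G) → ℕ} → (∀ u → f u ≡ g u) → sumNbr G v f ≡ sumNbr G v g
  sumNbr-cong f≗g = cong sum (map-cong (λ u → cong (if adj G v u then_else 0) (f≗g u)) (allFin (n G)))

  sumNbr-+ : ∀ (f g : Fin (n G) → ℕ) → sumNbr G v (λ u → f u + g u) ≡ sumNbr G v f + sumNbr G v g
  sumNbr-+ f g = trans (cong sum (map-cong (λ u → if-+ (adj G v u) (f u) (g u)) (allFin (n G))))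
                       (sum-map-+ _ _ (allFin (n G)))

module TwoColoring {G : Graph} (c : EdgeColoring G 2) where

  private
    isColor : Fin 2 → Fin 2 → ℕ
    isColor x i = if ⌊ x ≟ᶠ i ⌋ then 1 else 0

    colorValue-split : ∀ x → suc (toℕ x) ≡ 1 + isColor x 1F
    colorValue-split 0F = refl
    colorValue-split 1F = refl

    one-split : ∀ x → 1 ≡ isColor x 0F + isColor x 1F
    one-split 0F = refl
    one-split 1F = refl

  σ≡degree+colorCount₂ : ∀ v → σ c v ≡ degree G v + colorCount c v 1F
  σ≡degree+colorCount₂ v =
    trans (sumNbr-cong G v (λ u → colorValue-split (col c v u)))
          (sumNbr-+ G v _ _)

  degree≡colorCount₁+colorCount₂ : ∀ v → degree G v ≡ colorCount c v 0F + colorCount c v 1F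
  degree≡colorCount₁+colorCount₂ v =
    trans (sumNbr-cong G v (λ u → one-split (col c v u)))
          (sumNbr-+ G v _ _)

⌊n/2⌋≤-complement : ∀ {d s t} → d ≡ s + t → s ≤ ⌈ d /2⌉ → ⌊ d /2⌋ ≤ t
⌊n/2⌋≤-complement {d} {s} {t} d≡s+t s≤⌈d/2⌉ = +-cancelʳ-≤ s ⌊ d /2⌋ t (begin
  ⌊ d /2⌋ + s       ≤⟨ +-monoʳ-≤ ⌊ d /2⌋ s≤⌈d/2⌉ ⟩
  ⌊ d /2⌋ + ⌈ d /2⌉ ≡⟨ ⌊n/2⌋+⌈n/2⌉≡n d ⟩
  d                 ≡⟨ d≡s+t ⟩
  s + t             ≡⟨ +-comm s t ⟩
  t + s             ∎)
  where open ≤-Reasoning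

-- The window [d + ⌊d/2⌋, d + ⌈d/2⌉] ends just below the one for d + 1,
-- since d + ⌈d/2⌉ = d + ⌊(d+1)/2⌋ < (d+1) + ⌊(d+1)/2⌋.
+-halfWindow-strictMono : ∀ {d e s t} → d < e → s ≤ ⌈ d /2⌉ → ⌊ e /2⌋ ≤ t → d + s < e + t
+-halfWindow-strictMono {d} {e} {s} {t} d<e s≤⌈d/2⌉ ⌊e/2⌋≤t = begin-strict
  d + s               ≤⟨ +-monoʳ-≤ d s≤⌈d/2⌉ ⟩
  d + ⌈ d /2⌉         <⟨ ≤-refl ⟩
  suc d + ⌊ suc d /2⌋ ≤⟨ +-mono-≤ d<e (⌊n/2⌋-mono d<e) ⟩
  e + ⌊ e /2⌋         ≤⟨ +-monoʳ-≤ e ⌊e/2⌋≤t ⟩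
  e + t               ∎
  where open ≤-Reasoning

module _ {G : Graph} {c : EdgeColoring G 2} (qm : IsQM c) where
  open TwoColoring c

  σ-strictMono-degree : ∀ {u v} → degree G u < degree G v → σ c u < σ c v
  σ-strictMono-degree {u} {v} du<dv
    rewrite σ≡degree+colorCount₂ u | σ≡degree+colorCount₂ v =
    +-halfWindow-strictMono du<dv (qm u 1F)
      (⌊n/2⌋≤-complement (degree≡colorCount₁+colorCount₂ v) (qm v 0F))

  isNSD : AdjDistinctDegrees G → IsNSD c
  isNSD distinct u v uv σu≡σv with <-cmp (degree G u) (degree G v)
  ... | tri< du<dv _ _ = <⇒≢ (σ-strictMono-degree du<dv) σu≡σv
  ... | tri≈ _ du≡dv _ = distinct u v uv du≡dv
  ... | tri> _ _ dv<du = <⇒≢ (σ-strictMono-degree dv<du) (sym σu≡σv)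

mainTheorem16 : (G : Graph) → Nice G → AdjDistinctDegrees G →
    χqm≡ G 2 → χqmΣ≡ G 2
mainTheorem16 G _ distinct ((c , qm) , noSmallerQM) =
  (c , qm , isNSD {c = c} qm distinct) ,
  λ k k<2 (c′ , qm′ , _) → noSmallerQM k k<2 (c′ , qm′)
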